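{- Let $G_1$ and $G_2$ be series parallel digraphs. Then (1) $\mathrm{css}(\mathcal{T}(G_1\circ_s G_2))=\mathrm{css}(\mathcal{T}(G_1))\odot\mathrm{css}(\mathcal{T}(G_2))$, and (2) $\mathrm{css}(\mathcal{T}(G_1\parallel G_2))=\mathrm{css}(\mathcal{T}(G_1))\oplus_{nd}\mathrm{css}(\mathcal{T}(G_2))$.
   Context: A series parallel digraph (SPD) is a (multi)digraph with ordered terminals $(s,t)$ defined recursively: a single arc from $s$ to $t$ is an SPD; for SPDs $(G_1,(s_1,t_1))$, $(G_2,(s_2,t_2))$, the series composition $G_1\circ_s G_2$ is the disjoint union with $t_1$ and $s_2$ identified and terminals $(s_1,t_2)$, and the parallel composition $G_1\parallel G_2$ is the disjoint union with $s_1,s_2$ identified and $t_1,t_2$ identified, terminals $(s_1,t_1)$. For a DAG $G$ on $n$ vertices, $\mathcal{T}(G)$ is the set of topological orders (bijections $\sigma:V(G)\to[n]$ with $\sigma(u)<\sigma(v)$ for each arc $uv$). The cut-size sequence $\mathrm{css}(\sigma)$ is $x(1),\ldots,x(n-1)$ with $x(i)=|\{uv\in A(G):\sigma(u)\le i,\ \sigma(v)>i\}|$; for a set of orders, $\mathrm{css}$ is applied elementwise. For sets of sequences $A,B$: $A\odot B=\{a\circ b: a\in A, b\in B\}$ ($\circ$ = concatenation) and $A\oplus_{nd}B=\bigcup_{a\in A,b\in B}a\oplus_{nd}b$, where for sequences $a$ of length $p$ and $b$ of length $q$, $a\oplus_{nd}b$ is the set of sequences $t(1),\ldots,t(L)$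 for which there are index pairs $(a_1,b_1)=(1,1),\ldots,(a_L,b_L)=(p,q)$ with $(a_{k+1},b_{k+1})\in\{(a_k+1,b_k),(a_k,b_k+1)\}$ and $t(k)=a(a_k)+b(b_k)$. -}

module Defs where

open import Data.Nat using (ℕ; zero; suc; _+_; _∸_; _≤_; _≤?_; _<?_; s≤s)
open import Data.Nat.Properties using (+-suc; m≤m+n; _≟_)
open import Data.Fin as Fin using (Fin; zero; suc; toℕ; fromℕ; _↑ˡ_; _↑ʳ_; inject≤; cast)
open import Data.List using (List; []; _∷_; [_]; map; _++_; filter; length; applyUpTo)
open import Data.List.Membership.Propositional using (_∈_)
open import Data.Product using (_×_; _,_; proj₁; proj₂; ∃; ∃-syntax)
import Data.Product as Prod
open import Function.Bundles using (Bijection; _⤖_; _⇔_)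
open import Relation.Nullary using (yes; no)
open import Relation.Nullary.Decidable using (_×-dec_)
open import Relation.Binary.PropositionalEquality using (_≡_; cong; trans)

data SPD : Set where
  arc  : SPD
  _∘ₛ_ : SPD → SPD → SPD
  _∥_  : SPD → SPD → SPD

-- Number of non-terminal vertices; the SPD G has  2 + size G  vertices,
-- labelled by Fin (2 + size G), with source s = 0 and sink t = the last vertex.
size : SPD → ℕ
size arc       = 0
size (g ∘ₛ h)  = size g + suc (size h)
size (g ∥ h)   = size g + size h

-- Vertex embeddings for series composition: G₁ keeps its labels,
-- G₂'s vertex j goes to (n₁ - 1) + j, so t₁ and s₂ are identified.
ser₁ : ∀ k₁ k₂ → Fin (2 + k₁) → Fin (2 + (k₁ + suc k₂))
ser₁ k₁ k₂ i = i ↑ˡ suc k₂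

ser₂ : ∀ k₁ k₂ → Fin (2 + k₂) → Fin (2 + (k₁ + suc k₂))
ser₂ k₁ k₂ i = cast (cong suc (+-suc k₁ (suc k₂))) (suc k₁ ↑ʳ i)

-- Vertex embeddings for parallel composition: sources identified (vertex 0),
-- sinks identified (last vertex), inner vertices of G₁ keep their labels,
-- inner vertex j of G₂ goes to k₁ + j.
par₁ : ∀ k₁ k₂ → Fin (2 + k₁) → Fin (2 + (k₁ + k₂))
par₁ k₁ k₂ i with toℕ i ≟ suc k₁
... | yes _ = fromℕ (suc (k₁ + k₂))
... | no  _ = inject≤ i (s≤s (s≤s (m≤m+n k₁ k₂)))

par₂ : ∀ k₁ k₂ → Fin (2 + k₂) → Fin (2 + (k₁ + k₂))
par₂ k₁ k₂ zero    = zero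
par₂ k₁ k₂ (suc j) = cast (trans (+-suc k₁ (suc k₂)) (cong suc (+-suc k₁ k₂))) (k₁ ↑ʳ suc j)

mapArc : ∀ {m n} → (Fin m → Fin n) → Fin m × Fin m → Fin n × Fin n
mapArc f = Prod.map f f

arcs : (g : SPD) → List (Fin (2 + size g) × Fin (2 + size g))
arcs arc      = [ (zero , suc zero) ]
arcs (g ∘ₛ h) = map (mapArc (ser₁ (size g) (size h))) (arcs g)
             ++ map (mapArc (ser₂ (size g) (size h))) (arcs h)
arcs (g ∥ h)  = map (mapArc (par₁ (size g) (size h))) (arcs g)
             ++ map (mapArc (par₂ (size g) (size h))) (arcs h)

-- σ : V → [n] as a bijection Fin n ⤖ Fin n (position p ∈ Fin n stands for p+1 ∈ [n]).
record TopOrder (n : ℕ) (A : List (Fin n × Fin n)) : Set where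
  field
    σ        : Fin n ⤖ Fin n
    respects : ∀ {u v} → (u , v) ∈ A → Bijection.to σ u Fin.< Bijection.to σ v

-- x(i) = |{uv ∈ A : σ(u) ≤ i < σ(v)}|  (1-based σ, i.e. toℕ (σ u) < i ≤ toℕ (σ v))
cutSize : ∀ {n} → (Fin n → Fin n) → List (Fin n × Fin n) → ℕ → ℕ
cutSize σ A i =
  length (filter (λ e → (toℕ (σ (proj₁ e)) <? i) ×-dec (i ≤? toℕ (σ (proj₂ e)))) A)

css : ∀ {n} (A : List (Fin n × Fin n)) → TopOrder n A → List ℕ
css {n} A τ = applyUpTo (λ i → cutSize (Bijection.to (TopOrder.σ τ)) A (suc i)) (n ∸ 1)

SeqSet : Set₁
SeqSet = List ℕ → Set

cssT : SPD → SeqSet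
cssT g s = ∃[ τ ] css (arcs g) τ ≡ s

_⊙_ : SeqSet → SeqSet → SeqSet
(A ⊙ B) s = ∃[ a ] ∃[ b ] A a × B b × s ≡ a ++ b

-- t ∈ a ⊕nd b : a monotone lattice path of index pairs from (1,1) to (p,q),
-- each step increasing exactly one coordinate by 1, with t(k) = a(a_k) + b(b_k).
-- Unrolled inductively: each constructor records the current pair and one step.
data NDSum : List ℕ → List ℕ → List ℕ → Set where
  done  : ∀ {x y} → NDSum [ x ] [ y ] [ x + y ]
  stepˡ : ∀ {x x' y a b t} → NDSum (x' ∷ a) (y ∷ b) t
        → NDSum (x ∷ x' ∷ a) (y ∷ b) (x + y ∷ t)
  stepʳ : ∀ {x y y' a b t} → NDSum (x ∷ a) (y' ∷ b) t
        → NDSum (x ∷ a) (y ∷ y' ∷ b) (x + y ∷ t)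

_⊕nd_ : SeqSet → SeqSet → SeqSet
(A ⊕nd B) t = ∃[ a ] ∃[ b ] A a × B b × NDSum a b t

_≐_ : SeqSet → SeqSet → Set
A ≐ B = ∀ s → A s ⇔ B s

-- A topological order is handled as a numbering f : Fin n → ℕ that is injective, bounded
-- by n and increasing along arcs; the cut size at i depends only on the down-set
-- {v | f v < i}. In every such numbering of an SPD the source comes first and the sink last.
--
-- Series: by pigeonhole the junction vertex gets the number |V(G₁)| - 1, so every order
-- lists G₁ before G₂ and its cut sequence is the concatenation of the two restricted ones;
-- conversely, any two orders can be concatenated.
--
-- Parallel: an order of G₁ ∥ G₂ restricts, after ranking, to orders of G₁ and G₂, and
-- recording for each inner position the side of the vertex there gives a lattice path
-- along which every cut size is the sum of the two cut sizes reached; conversely, two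
-- orders can be merged along any lattice path.

module Submission where

open import Defs
open import Data.Bool using (Bool; true; false; if_then_else_)
import Data.Bool.Properties as Bool
open import Data.Empty using (⊥; ⊥-elim)
open import Data.Fin as Fin using (Fin; zero; suc; toℕ; fromℕ; fromℕ<; punchOut)
import Data.Fin.Properties as Fin
open import Data.List using (List; []; _∷_; map; _++_; filter; length; applyUpTo)
open import Data.List.Properties
  using (∷-injectiveˡ; ∷-injectiveʳ; filter-++; filter-≐; filter-none; length-++)
open import Data.List.Membership.Propositional using (_∈_)
open import Data.List.Relation.Unary.Any using (here)
open import Data.List.Membership.Propositional.Properties
  using (∈-map⁺; ∈-map⁻; ∈-++⁺ˡ; ∈-++⁺ʳ; ∈-++⁻)
import Data.List.Relation.Unary.All as All
open import Data.Nat using (ℕ; zero; suc; _+_; _∸_; _≤_; _<_; _≤?_; _<?_; s≤s; z≤n)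
open import Data.Nat.Properties
open import Data.Product using (_×_; _,_; proj₁; proj₂; ∃; ∃₂; ∃-syntax)
open import Data.Sum using (_⊎_; inj₁; inj₂; [_,_]′)
open import Function using (_∘_)
open import Level using (0ℓ)
open import Function.Definitions using (Injective)
open import Function.Bundles using (Bijection; Equivalence; mk⤖; mk⇔)
import Function.Properties.Equivalence as ⇔
open import Relation.Nullary using (yes; no; ¬_; does; contradiction)
open import Relation.Nullary.Decidable using (_×-dec_)
open import Relation.Unary using (Pred; Decidable)
open import Relation.Binary.PropositionalEquality
open import Relation.Binary.Definitions using (tri<; tri≈; tri>)

-- Lattice paths

-- A step sequence w describes a monotone lattice path: step k + 1 moves in the
-- second coordinate iff w k ≡ true, so after k steps the path is at
-- (count false w k , count true w k).
hit : Bool → Bool → ℕ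
hit c b = if does (c Bool.≟ b) then 1 else 0

count : Bool → (ℕ → Bool) → ℕ → ℕ
count c w zero    = 0
count c w (suc k) = hit c (w 0) + count c (w ∘ suc) k

hit-≡ : ∀ {c b} → c ≡ b → hit c b ≡ 1
hit-≡ {false} refl = refl
hit-≡ {true}  refl = refl

hit-≢ : ∀ {c b} → c ≢ b → hit c b ≡ 0
hit-≢ {false} {false} c≢b = ⊥-elim (c≢b refl)
hit-≢ {false} {true}  _   = refl
hit-≢ {true}  {false} _   = refl
hit-≢ {true}  {true}  c≢b = ⊥-elim (c≢b refl)

count-suc : ∀ c w k → count c w (suc k) ≡ count c w k + hit c (w k)
count-suc c w zero    = +-comm (hit c (w 0)) 0
count-suc c w (suc k) = trans (cong (hit c (w 0) +_) (count-suc c (w ∘ suc) k))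
                              (sym (+-assoc (hit c (w 0)) _ _))

count-false+true : ∀ w k → count false w k + count true w k ≡ k
count-false+true w zero = refl
count-false+true w (suc k) with w 0
... | false = cong suc (count-false+true (w ∘ suc) k)
... | true  = trans (+-suc _ _) (cong suc (count-false+true (w ∘ suc) k))

count-mono : ∀ c w {k l} → k ≤ l → count c w k ≤ count c w l
count-mono c w {zero}  _           = z≤n
count-mono c w {suc k} (s≤s k≤l) = +-monoʳ-≤ (hit c (w 0)) (count-mono c (w ∘ suc) k≤l)

-- The sequence t(k) = x(a_k) + y(b_k) of ⊕nd, for the path of w with L steps.
pathSum : (ℕ → ℕ) → (ℕ → ℕ) → (ℕ → Bool) → ℕ → List ℕ
pathSum x y w L = applyUpTo (λ k → x (count false w k) + y (count true w k)) (suc L)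

_◃_ : Bool → (ℕ → Bool) → ℕ → Bool
(b ◃ w) zero    = b
(b ◃ w) (suc k) = w k

pathSum-NDSum : ∀ x y w L →
  NDSum (applyUpTo x (suc (count false w L))) (applyUpTo y (suc (count true w L))) (pathSum x y w L)
pathSum-NDSum x y w zero = done
pathSum-NDSum x y w (suc L) with w 0
... | false = stepˡ (pathSum-NDSum (x ∘ suc) y (w ∘ suc) L)
... | true  = stepʳ (pathSum-NDSum x (y ∘ suc) (w ∘ suc) L)

NDSum-pathSum : ∀ {a b t} → NDSum a b t → ∀ x p y q →
  a ≡ applyUpTo x (suc p) → b ≡ applyUpTo y (suc q) →
  ∃₂ λ w L → count false w L ≡ p × count true w L ≡ q × t ≡ pathSum x y w L
NDSum-pathSum done x zero    y zero    refl refl = (λ _ → false) , 0 , refl , refl , refl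
NDSum-pathSum done x zero    y (suc q) _    ()
NDSum-pathSum done x (suc p) y q       ()   _
NDSum-pathSum (stepˡ nd) x zero    y q ()   _
NDSum-pathSum (stepˡ nd) x (suc p) y q a≡   refl
  with w , L , p≡ , q≡ , t≡ ← NDSum-pathSum nd (x ∘ suc) p y q (∷-injectiveʳ a≡) refl
  rewrite ∷-injectiveˡ a≡
  = false ◃ w , suc L , cong suc p≡ , q≡ , cong (_ ∷_) t≡
NDSum-pathSum (stepʳ nd) x p y zero    _    ()
NDSum-pathSum (stepʳ nd) x p y (suc q) refl b≡
  with w , L , p≡ , q≡ , t≡ ← NDSum-pathSum nd x p (y ∘ suc) q refl (∷-injectiveʳ b≡)
  rewrite ∷-injectiveˡ b≡
  = true ◃ w , suc L , p≡ , cong suc q≡ , cong (_ ∷_) t≡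

select : Bool → (ℕ → Bool) → ℕ → ℕ → ℕ
select c w zero    a = 0
select c w (suc L) a with c Bool.≟ w 0 | a
... | yes _ | zero   = 0
... | yes _ | suc a' = suc (select c (w ∘ suc) L a')
... | no _  | _      = suc (select c (w ∘ suc) L a)

select-spec : ∀ c w L a → a < count c w L →
  select c w L a < L × w (select c w L a) ≡ c × count c w (select c w L a) ≡ a
select-spec c w (suc L) a a< with c Bool.≟ w 0 | a
... | yes c≡ | zero   = s≤s z≤n , sym c≡ , refl
... | yes c≡ | suc a′ =
  let (s< , ws≡ , count≡) = select-spec c (w ∘ suc) L a′ (≤-pred a<)
  in s≤s s< , ws≡ , cong₂ _+_ (hit-≡ c≡) count≡
... | no c≢  | a      =
  let (s< , ws≡ , count≡) = select-spec c (w ∘ suc) L a a<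
  in s≤s s< , ws≡ , cong₂ _+_ (hit-≢ c≢) count≡

module _ (c : Bool) (w : ℕ → Bool) (L : ℕ) {a : ℕ} (a<K : a < count c w L) where

  select<L : select c w L a < L
  select<L = proj₁ (select-spec c w L a a<K)

  select-hits : w (select c w L a) ≡ c
  select-hits = proj₁ (proj₂ (select-spec c w L a a<K))

  count-select : count c w (select c w L a) ≡ a
  count-select = proj₂ (proj₂ (select-spec c w L a a<K))

  select<⇒ : ∀ m → select c w L a < m → a < count c w m
  select<⇒ m s<m = begin-strict
    a                          <⟨ n<1+n a ⟩
    suc a                      ≡⟨ +-comm 1 a ⟩
    a + 1                      ≡⟨ sym (cong₂ _+_ count-select (hit-≡ (sym select-hits))) ⟩
    count c w s + hit c (w s)  ≡⟨ sym (count-suc c w s) ⟩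
    count c w (suc s)          ≤⟨ count-mono c w s<m ⟩
    count c w m                ∎
    where
    open ≤-Reasoning
    s : ℕ
    s = select c w L a

  select<⇐ : ∀ m → a < count c w m → select c w L a < m
  select<⇐ m a<count with select c w L a <? m
  ... | yes s<m = s<m
  ... | no  s≮m = ⊥-elim (≤⇒≯ (subst (count c w m ≤_) count-select (count-mono c w (≮⇒≥ s≮m))) a<count)

-- slot c w L a is the position, in the merge along w, of the element of rank a of the
-- side c: rank 0 (a source) goes first, ranks 1 … count c w L follow the c-steps, and
-- rank count c w L + 1 (a sink) goes last, at L + 1.
slot : Bool → (ℕ → Bool) → ℕ → ℕ → ℕ
slot c w L zero    = 0
slot c w L (suc a) with a <? count c w L
... | yes _ = suc (select c w L a)
... | no  _ = suc L

module _ (c : Bool) (w : ℕ → Bool) (L : ℕ) where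

  slot-top : slot c w L (suc (count c w L)) ≡ suc L
  slot-top with count c w L <? count c w L
  ... | yes K<K = ⊥-elim (n≮n _ K<K)
  ... | no  _   = refl

  slot-≤ : ∀ a → slot c w L a ≤ suc L
  slot-≤ zero    = z≤n
  slot-≤ (suc a) with a <? count c w L
  ... | yes a<K = s≤s (<⇒≤ (select<L c w L a<K))
  ... | no  _   = ≤-refl

  slot<⇒ : ∀ a k → k ≤ L → slot c w L a < suc k → a < suc (count c w k)
  slot<⇒ zero    k _   _ = s≤s z≤n
  slot<⇒ (suc a) k k≤L s< with a <? count c w L
  ... | yes a<K = s≤s (select<⇒ c w L a<K k (≤-pred s<))
  ... | no  _   = ⊥-elim (≤⇒≯ k≤L (≤-pred s<))

  slot<⇐ : ∀ a k → k ≤ L → a < suc (count c w k) → slot c w L a < suc k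
  slot<⇐ zero    k _   _ = s≤s z≤n
  slot<⇐ (suc a) k k≤L a< with a <? count c w L
  ... | yes a<K = s≤s (select<⇐ c w L a<K k (≤-pred a<))
  ... | no  a≮K = ⊥-elim (a≮K (<-≤-trans (≤-pred a<) (count-mono c w k≤L)))

  slot-strict : ∀ {a b} → a < b → b ≤ suc (count c w L) → slot c w L a < slot c w L b
  slot-strict {zero}  {suc b} _ _ with b <? count c w L
  ... | yes _ = s≤s z≤n
  ... | no  _ = s≤s z≤n
  slot-strict {suc a} {suc b} (s≤s a<b) (s≤s b≤K) with a <? count c w L | b <? count c w L
  ... | yes a<K | yes b<K = s≤s (select<⇐ c w L a<K _ (subst (a <_) (sym (count-select c w L b<K)) a<b))
  ... | yes a<K | no  _   = s≤s (select<L c w L a<K)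
  ... | no  a≮K | _       = ⊥-elim (a≮K (<-≤-trans a<b b≤K))

  slot-injective : ∀ {a b} → a ≤ suc (count c w L) → b ≤ suc (count c w L) →
                   slot c w L a ≡ slot c w L b → a ≡ b
  slot-injective {a} {b} a≤ b≤ s≡ with <-cmp a b
  ... | tri< a<b _ _ = ⊥-elim (<⇒≢ (slot-strict a<b b≤) s≡)
  ... | tri≈ _ a≡b _ = a≡b
  ... | tri> _ _ b<a = ⊥-elim (<⇒≢ (slot-strict b<a a≤) (sym s≡))

slot-coincide : ∀ w L {a b} → a ≤ suc (count false w L) → b ≤ suc (count true w L) →
  slot false w L a ≡ slot true w L b →
  (a ≡ 0 × b ≡ 0) ⊎ (a ≡ suc (count false w L) × b ≡ suc (count true w L))
slot-coincide w L {zero}  {zero}  _ _ _ = inj₁ (refl , refl)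
slot-coincide w L {zero}  {suc b} _ _ s≡ with b <? count true w L
... | yes _ = ⊥-elim (0≢1+n s≡)
... | no  _ = ⊥-elim (0≢1+n s≡)
slot-coincide w L {suc a} {zero}  _ _ s≡ with a <? count false w L
... | yes _ = ⊥-elim (0≢1+n (sym s≡))
... | no  _ = ⊥-elim (0≢1+n (sym s≡))
slot-coincide w L {suc a} {suc b} (s≤s a≤) (s≤s b≤) s≡
  with a <? count false w L | b <? count true w L
... | yes a<K | yes b<K =
  contradiction (trans (sym (select-hits false w L a<K))
                       (trans (cong w (suc-injective s≡)) (select-hits true w L b<K))) λ ()
... | yes a<K | no  _   = ⊥-elim (<⇒≢ (select<L false w L a<K) (suc-injective s≡))
... | no  _   | yes b<K = ⊥-elim (<⇒≢ (select<L true w L b<K) (sym (suc-injective s≡)))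
... | no  a≮K | no  b≮K = inj₂ (cong suc (≤-antisym a≤ (≮⇒≥ a≮K)) , cong suc (≤-antisym b≤ (≮⇒≥ b≮K)))

countBelow : ∀ {m} → (Fin m → ℕ) → ℕ → ℕ
countBelow {zero}  φ i = 0
countBelow {suc m} φ i with φ zero <? i
... | yes _ = suc (countBelow (φ ∘ suc) i)
... | no  _ = countBelow (φ ∘ suc) i

countAt : ∀ {m} → (Fin m → ℕ) → ℕ → ℕ
countAt {zero}  φ i = 0
countAt {suc m} φ i with φ zero ≟ i
... | yes _ = suc (countAt (φ ∘ suc) i)
... | no  _ = countAt (φ ∘ suc) i

countBelow-suc : ∀ {m} (φ : Fin m → ℕ) i → countBelow φ (suc i) ≡ countBelow φ i + countAt φ i
countBelow-suc {zero}  φ i = refl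
countBelow-suc {suc m} φ i with φ zero <? suc i | φ zero <? i | φ zero ≟ i
... | yes _    | yes _    | no  _    = cong suc (countBelow-suc (φ ∘ suc) i)
... | yes _    | yes φ<i  | yes refl = ⊥-elim (n≮n _ φ<i)
... | yes _    | no  _    | yes _    = trans (cong suc (countBelow-suc (φ ∘ suc) i)) (sym (+-suc _ _))
... | yes φ<1+i | no φ≮i  | no φ≢i   = ⊥-elim (φ≢i (≤-antisym (≤-pred φ<1+i) (≮⇒≥ φ≮i)))
... | no  φ≮1+i | yes φ<i | _        = ⊥-elim (φ≮1+i (m<n⇒m<1+n φ<i))
... | no  φ≮1+i | no  _   | yes refl = ⊥-elim (φ≮1+i ≤-refl)
... | no  _    | no  _    | no  _    = countBelow-suc (φ ∘ suc) i

countBelow-zero : ∀ {m} (φ : Fin m → ℕ) → countBelow φ 0 ≡ 0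
countBelow-zero {zero}  φ = refl
countBelow-zero {suc m} φ with φ zero <? 0
... | no _ = countBelow-zero (φ ∘ suc)

countBelow-all : ∀ {m} (φ : Fin m → ℕ) i → (∀ x → φ x < i) → countBelow φ i ≡ m
countBelow-all {zero}  φ i _   = refl
countBelow-all {suc m} φ i φ<i with φ zero <? i
... | yes _   = cong suc (countBelow-all (φ ∘ suc) i (φ<i ∘ suc))
... | no  φ≮i = ⊥-elim (φ≮i (φ<i zero))

countAt-none : ∀ {m} (φ : Fin m → ℕ) i → (∀ x → φ x ≢ i) → countAt φ i ≡ 0
countAt-none {zero}  φ i _   = refl
countAt-none {suc m} φ i φ≢i with φ zero ≟ i
... | yes φ≡i = ⊥-elim (φ≢i zero φ≡i)
... | no  _   = countAt-none (φ ∘ suc) i (φ≢i ∘ suc)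

countAt-unique : ∀ {m} (φ : Fin m → ℕ) → Injective _≡_ _≡_ φ → ∀ {x i} → φ x ≡ i → countAt φ i ≡ 1
countAt-unique {suc m} φ φ-inj {zero}  {i} φx≡i with φ zero ≟ i
... | yes _   = cong suc (countAt-none (φ ∘ suc) i λ y φy≡i → Fin.0≢1+n (φ-inj (trans φx≡i (sym φy≡i))))
... | no  φ≢i = ⊥-elim (φ≢i φx≡i)
countAt-unique {suc m} φ φ-inj {suc x} {i} φx≡i with φ zero ≟ i
... | yes φ0≡i = ⊥-elim (Fin.0≢1+n (φ-inj (trans φ0≡i (sym φx≡i))))
... | no  _    = countAt-unique (φ ∘ suc) (Fin.suc-injective ∘ φ-inj) φx≡i

countBelow-mono : ∀ {m} (φ ψ : Fin m → ℕ) i j → (∀ x → φ x < i → ψ x < j) → countBelow φ i ≤ countBelow ψ j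
countBelow-mono {zero}  φ ψ i j _  = z≤n
countBelow-mono {suc m} φ ψ i j φψ with φ zero <? i | ψ zero <? j
... | yes _   | yes _   = s≤s (countBelow-mono (φ ∘ suc) (ψ ∘ suc) i j (φψ ∘ suc))
... | yes φ<i | no  ψ≮j = ⊥-elim (ψ≮j (φψ zero φ<i))
... | no  _   | yes _   = m≤n⇒m≤1+n (countBelow-mono (φ ∘ suc) (ψ ∘ suc) i j (φψ ∘ suc))
... | no  _   | no  _   = countBelow-mono (φ ∘ suc) (ψ ∘ suc) i j (φψ ∘ suc)

countBelow-strict : ∀ {m} (φ ψ : Fin m → ℕ) i j → (∀ x → φ x < i → ψ x < j) →
                    ∀ x → ¬ φ x < i → ψ x < j → countBelow φ i < countBelow ψ j
countBelow-strict {suc m} φ ψ i j φψ zero φ≮i ψ<j with φ zero <? i | ψ zero <? j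
... | yes φ<i | _       = ⊥-elim (φ≮i φ<i)
... | no  _   | yes _   = s≤s (countBelow-mono (φ ∘ suc) (ψ ∘ suc) i j (φψ ∘ suc))
... | no  _   | no  ψ≮j = ⊥-elim (ψ≮j ψ<j)
countBelow-strict {suc m} φ ψ i j φψ (suc x) φ≮i ψ<j with φ zero <? i | ψ zero <? j
... | yes _   | yes _   = s≤s (countBelow-strict (φ ∘ suc) (ψ ∘ suc) i j (φψ ∘ suc) x φ≮i ψ<j)
... | yes φ<i | no  ψ≮j = ⊥-elim (ψ≮j (φψ zero φ<i))
... | no  _   | yes _   = m<n⇒m<1+n (countBelow-strict (φ ∘ suc) (ψ ∘ suc) i j (φψ ∘ suc) x φ≮i ψ<j)
... | no  _   | no  _   = countBelow-strict (φ ∘ suc) (ψ ∘ suc) i j (φψ ∘ suc) x φ≮i ψ<j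

rank : ∀ {m} → (Fin m → ℕ) → Fin m → ℕ
rank φ x = countBelow φ (φ x)

module _ {m : ℕ} (φ : Fin m → ℕ) where

  rank<m : ∀ x → rank φ x < m
  rank<m x = subst (rank φ x <_) (countBelow-all (λ _ → 0) 1 (λ _ → s≤s z≤n))
               (countBelow-strict φ (λ _ → 0) (φ x) 1 (λ _ _ → s≤s z≤n) x (n≮n _) (s≤s z≤n))

  rank-strict : ∀ {x y} → φ x < φ y → rank φ x < rank φ y
  rank-strict {x} φx<φy = countBelow-strict φ φ (φ x) _ (λ _ φz<φx → <-trans φz<φx φx<φy) x (n≮n _) φx<φy

  rank-injective : Injective _≡_ _≡_ φ → Injective _≡_ _≡_ (rank φ)
  rank-injective φ-inj {x} {y} r≡ with <-cmp (φ x) (φ y)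
  ... | tri< φx<φy _ _ = ⊥-elim (<⇒≢ (rank-strict φx<φy) r≡)
  ... | tri≈ _ φx≡φy _ = φ-inj φx≡φy
  ... | tri> _ _ φy<φx = ⊥-elim (<⇒≢ (rank-strict φy<φx) (sym r≡))

  rank<⇐ : ∀ x i → φ x < i → rank φ x < countBelow φ i
  rank<⇐ x i φx<i = countBelow-strict φ φ (φ x) i (λ _ φz<φx → <-trans φz<φx φx<i) x (n≮n _) φx<i

  rank<⇒ : ∀ x i → rank φ x < countBelow φ i → φ x < i
  rank<⇒ x i r< with φ x <? i
  ... | yes φx<i = φx<i
  ... | no  φx≮i = ⊥-elim (≤⇒≯ (countBelow-mono φ φ i (φ x) (λ _ φz<i → <-≤-trans φz<i (≮⇒≥ φx≮i))) r<)

Arcs : ℕ → Set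
Arcs n = List (Fin n × Fin n)

cut : ∀ {n} → (Fin n → ℕ) → Arcs n → ℕ → ℕ
cut f A i = length (filter (λ e → (f (proj₁ e) <? i) ×-dec (i ≤? f (proj₂ e))) A)

cutSeq : ∀ {n} → (Fin n → ℕ) → Arcs n → ℕ → List ℕ
cutSeq f A m = applyUpTo (cut f A ∘ suc) m

length-filter-map : ∀ {A B : Set} {P : Pred B 0ℓ} (P? : Decidable P) (g : A → B) xs →
                    length (filter P? (map g xs)) ≡ length (filter (P? ∘ g) xs)
length-filter-map P? g []       = refl
length-filter-map P? g (x ∷ xs) with does (P? (g x))
... | true  = cong suc (length-filter-map P? g xs)
... | false = length-filter-map P? g xs

module _ {n : ℕ} (f : Fin n → ℕ) where

  cut-++ : ∀ A B i → cut f (A ++ B) i ≡ cut f A i + cut f B i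
  cut-++ A B i = trans (cong length (filter-++ _ A B)) (length-++ (filter _ A))

  cut-map : ∀ {m} (e : Fin m → Fin n) A i → cut f (map (mapArc e) A) i ≡ cut (f ∘ e) A i
  cut-map e A i = length-filter-map _ (mapArc e) A

  -- An arc is cut at i exactly when its tail lies in {x | f x < i} and its head does
  -- not, so the cut size only depends on that down-set.
  cut-cong : ∀ (h : Fin n → ℕ) A {i j} →
             (∀ x → f x < i → h x < j) → (∀ x → h x < j → f x < i) → cut f A i ≡ cut h A j
  cut-cong h A {i} {j} f⇒h h⇒f = cong length (filter-≐ _ _ (cut-f⇒h , cut-h⇒f) A)
    where
    cut-f⇒h : ∀ {e} → f (proj₁ e) < i × i ≤ f (proj₂ e) → h (proj₁ e) < j × j ≤ h (proj₂ e)
    cut-f⇒h {u , v} (fu<i , i≤fv) = f⇒h u fu<i , ≮⇒≥ (λ hv<j → ≤⇒≯ i≤fv (h⇒f v hv<j))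
    cut-h⇒f : ∀ {e} → h (proj₁ e) < j × j ≤ h (proj₂ e) → f (proj₁ e) < i × i ≤ f (proj₂ e)
    cut-h⇒f {u , v} (hu<j , j≤hv) = h⇒f u hu<j , ≮⇒≥ (λ fv<i → ≤⇒≯ j≤hv (f⇒h v fv<i))

  cut-≤all : ∀ A i → (∀ x → i ≤ f x) → cut f A i ≡ 0
  cut-≤all A i i≤f =
    cong length (filter-none _ (All.universal (λ { (u , v) (fu<i , _) → ≤⇒≯ (i≤f u) fu<i }) A))

  cut-all< : ∀ A i → (∀ x → f x < i) → cut f A i ≡ 0
  cut-all< A i f<i =
    cong length (filter-none _ (All.universal (λ { (u , v) (_ , i≤fv) → ≤⇒≯ i≤fv (f<i v) }) A))

applyUpTo-cong : ∀ {A : Set} (f g : ℕ → A) m → (∀ i → i < m → f i ≡ g i) → applyUpTo f m ≡ applyUpTo g m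
applyUpTo-cong f g zero    _   = refl
applyUpTo-cong f g (suc m) f≡g =
  cong₂ _∷_ (f≡g 0 (s≤s z≤n)) (applyUpTo-cong (f ∘ suc) (g ∘ suc) m (λ i i<m → f≡g (suc i) (s≤s i<m)))

applyUpTo-+ : ∀ {A : Set} (f : ℕ → A) a b →
              applyUpTo f (a + b) ≡ applyUpTo f a ++ applyUpTo (λ j → f (a + j)) b
applyUpTo-+ f zero    b = refl
applyUpTo-+ f (suc a) b = cong (f 0 ∷_) (applyUpTo-+ (f ∘ suc) a b)

cutSeq-cong : ∀ {n} (f h : Fin n → ℕ) A m → (∀ x → f x ≡ h x) → cutSeq f A m ≡ cutSeq h A m
cutSeq-cong f h A m f≡h = applyUpTo-cong _ _ m λ i _ →
  cut-cong f h A (λ x fx<i → subst (_< suc i) (f≡h x) fx<i) (λ x hx<i → subst (_< suc i) (sym (f≡h x)) hx<i)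

-- Topological numberings

Increasing : ∀ {n} → (Fin n → ℕ) → Arcs n → Set
Increasing f A = ∀ {u v} → (u , v) ∈ A → f u < f v

record TopNumbering (n : ℕ) (A : Arcs n) : Set where
  field
    num        : Fin n → ℕ
    num<n      : ∀ v → num v < n
    injective  : Injective _≡_ _≡_ num
    increasing : Increasing num A

open TopNumbering

injective⇒≤ : ∀ {m b} (φ : Fin m → ℕ) → Injective _≡_ _≡_ φ → (∀ x → φ x < b) → m ≤ b
injective⇒≤ φ φ-inj φ<b = Fin.injective⇒≤ {f = λ x → fromℕ< (φ<b x)} λ {x} {y} e →
  φ-inj (trans (sym (Fin.toℕ-fromℕ< (φ<b x))) (trans (cong toℕ e) (Fin.toℕ-fromℕ< (φ<b y))))

injective⇒surjective : ∀ {n} (t : Fin n → Fin n) → Injective _≡_ _≡_ t → ∀ y → ∃ λ x → t x ≡ y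
injective⇒surjective {suc n} t t-inj y with Fin.any? (λ x → t x Fin.≟ y)
... | yes hit = hit
... | no  miss = ⊥-elim (1+n≰n (Fin.injective⇒≤ t′-inj))
  where
  y≢t : ∀ x → y ≢ t x
  y≢t x y≡tx = miss (x , sym y≡tx)
  t′ : Fin (suc n) → Fin n
  t′ x = punchOut (y≢t x)
  t′-inj : Injective _≡_ _≡_ t′
  t′-inj {a} {b} e = t-inj (Fin.punchOut-injective (y≢t a) (y≢t b) e)

module _ {n : ℕ} {A : Arcs n} (N : TopNumbering n A) where

  position : Fin n → Fin n
  position v = fromℕ< (num<n N v)

  toℕ-position : ∀ v → toℕ (position v) ≡ num N v
  toℕ-position v = Fin.toℕ-fromℕ< (num<n N v)

  position-injective : Injective _≡_ _≡_ position
  position-injective {u} {v} e =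
    injective N (trans (sym (toℕ-position u)) (trans (cong toℕ e) (toℕ-position v)))

  num-onto : ∀ p → p < n → ∃ λ v → num N v ≡ p
  num-onto p p<n with injective⇒surjective position position-injective (fromℕ< p<n)
  ... | v , e = v , trans (sym (toℕ-position v)) (trans (cong toℕ e) (Fin.toℕ-fromℕ< p<n))

  toTopOrder : TopOrder n A
  toTopOrder = record
    { σ        = mk⤖ (position-injective , λ y →
                   let (x , e) = injective⇒surjective position position-injective y in x , λ { refl → e })
    ; respects = λ {u} {v} uv∈A →
                   subst₂ _<_ (sym (toℕ-position u)) (sym (toℕ-position v)) (increasing N uv∈A)
    }

fromTopOrder : ∀ {n} {A : Arcs n} → TopOrder n A → TopNumbering n A
fromTopOrder τ = record
  { num        = toℕ ∘ Bijection.to σ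
  ; num<n      = λ v → Fin.toℕ<n (Bijection.to σ v)
  ; injective  = Bijection.injective σ ∘ Fin.toℕ-injective
  ; increasing = respects
  }
  where open TopOrder τ

≐-sym : ∀ {A B} → A ≐ B → B ≐ A
≐-sym A≐B s = ⇔.sym (A≐B s)

≐-trans : ∀ {A B C} → A ≐ B → B ≐ C → A ≐ C
≐-trans A≐B B≐C s = ⇔.trans (A≐B s) (B≐C s)

⊙-cong : ∀ {A A′ B B′} → A ≐ A′ → B ≐ B′ → (A ⊙ B) ≐ (A′ ⊙ B′)
⊙-cong A≐ B≐ s = mk⇔
  (λ (a , b , Aa , Bb , s≡) → a , b , Equivalence.to (A≐ a) Aa , Equivalence.to (B≐ b) Bb , s≡)
  (λ (a , b , Aa , Bb , s≡) → a , b , Equivalence.from (A≐ a) Aa , Equivalence.from (B≐ b) Bb , s≡)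

⊕nd-cong : ∀ {A A′ B B′} → A ≐ A′ → B ≐ B′ → (A ⊕nd B) ≐ (A′ ⊕nd B′)
⊕nd-cong A≐ B≐ s = mk⇔
  (λ (a , b , Aa , Bb , nd) → a , b , Equivalence.to (A≐ a) Aa , Equivalence.to (B≐ b) Bb , nd)
  (λ (a , b , Aa , Bb , nd) → a , b , Equivalence.from (A≐ a) Aa , Equivalence.from (B≐ b) Bb , nd)

Css : SPD → SeqSet
Css g s = ∃[ N ] cutSeq (num {2 + size g} {arcs g} N) (arcs g) (suc (size g)) ≡ s

cssT≐Css : ∀ g → cssT g ≐ Css g
cssT≐Css g s = mk⇔ (λ (τ , css≡s) → fromTopOrder τ , css≡s)
                   (λ (N , cut≡s) → toTopOrder N , trans (cutSeq-cong _ _ (arcs g) _ (toℕ-position N)) cut≡s)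

sink : ∀ k → Fin (2 + k)
sink k = fromℕ (suc k)

toℕ-sink : ∀ k → toℕ (sink k) ≡ suc k
toℕ-sink k = Fin.toℕ-fromℕ (suc k)

module _ (k₁ k₂ : ℕ) where

  toℕ-ser₁ : ∀ a → toℕ (ser₁ k₁ k₂ a) ≡ toℕ a
  toℕ-ser₁ a = Fin.toℕ-↑ˡ a (suc k₂)

  toℕ-ser₂ : ∀ b → toℕ (ser₂ k₁ k₂ b) ≡ suc k₁ + toℕ b
  toℕ-ser₂ b = trans (Fin.toℕ-cast (cong suc (+-suc k₁ (suc k₂))) (suc k₁ Fin.↑ʳ b)) (Fin.toℕ-↑ʳ (suc k₁) b)

  ser₁-injective : Injective _≡_ _≡_ (ser₁ k₁ k₂)
  ser₁-injective {a} {a′} e = Fin.toℕ-injective (trans (sym (toℕ-ser₁ a)) (trans (cong toℕ e) (toℕ-ser₁ a′)))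

  ser₂-injective : Injective _≡_ _≡_ (ser₂ k₁ k₂)
  ser₂-injective {b} {b′} e =
    Fin.toℕ-injective (+-cancelˡ-≡ (suc k₁) _ _ (trans (sym (toℕ-ser₂ b)) (trans (cong toℕ e) (toℕ-ser₂ b′))))

  ser-junction : ser₁ k₁ k₂ (sink k₁) ≡ ser₂ k₁ k₂ zero
  ser-junction = Fin.toℕ-injective (begin
    toℕ (ser₁ k₁ k₂ (sink k₁))  ≡⟨ toℕ-ser₁ (sink k₁) ⟩
    toℕ (sink k₁)               ≡⟨ toℕ-sink k₁ ⟩
    suc k₁                      ≡⟨ sym (+-identityʳ (suc k₁)) ⟩
    suc k₁ + 0                  ≡⟨ sym (toℕ-ser₂ zero) ⟩
    toℕ (ser₂ k₁ k₂ zero)       ∎)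
    where open ≡-Reasoning

  ser₂-sink : ser₂ k₁ k₂ (sink k₂) ≡ sink (k₁ + suc k₂)
  ser₂-sink = Fin.toℕ-injective (begin
    toℕ (ser₂ k₁ k₂ (sink k₂))  ≡⟨ toℕ-ser₂ (sink k₂) ⟩
    suc k₁ + toℕ (sink k₂)      ≡⟨ cong (suc k₁ +_) (toℕ-sink k₂) ⟩
    suc k₁ + suc k₂             ≡⟨ sym (toℕ-sink (k₁ + suc k₂)) ⟩
    toℕ (sink (k₁ + suc k₂))    ∎)
    where open ≡-Reasoning

  ser-cover : ∀ v → (∃ λ a → ser₁ k₁ k₂ a ≡ v) ⊎ (∃ λ b → ser₂ k₁ k₂ b ≡ v)
  ser-cover v with Fin.splitAt (2 + k₁) v | Fin.join-splitAt (2 + k₁) (suc k₂) v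
  ... | inj₁ a | join≡v = inj₁ (a , join≡v)
  ... | inj₂ j | join≡v = inj₂ (suc j , trans (Fin.toℕ-injective (begin
    toℕ (ser₂ k₁ k₂ (suc j))        ≡⟨ toℕ-ser₂ (suc j) ⟩
    suc k₁ + suc (toℕ j)            ≡⟨ +-suc (suc k₁) (toℕ j) ⟩
    2 + k₁ + toℕ j                  ≡⟨ sym (Fin.toℕ-↑ʳ (2 + k₁) j) ⟩
    toℕ ((2 + k₁) Fin.↑ʳ j)         ∎)) join≡v)
    where open ≡-Reasoning

  ser-overlap : ∀ {a b} → ser₁ k₁ k₂ a ≡ ser₂ k₁ k₂ b → a ≡ sink k₁ × b ≡ zero
  ser-overlap {a} {b} e = a≡sink , b≡zero
    where
    a≡ : toℕ a ≡ suc k₁ + toℕ b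
    a≡ = trans (sym (toℕ-ser₁ a)) (trans (cong toℕ e) (toℕ-ser₂ b))
    b≡0 : toℕ b ≡ 0
    b≡0 = n≤0⇒n≡0 (+-cancelˡ-≤ (suc k₁) _ _
            (subst (_≤ suc k₁ + 0) a≡ (subst (toℕ a ≤_) (sym (+-identityʳ (suc k₁))) (≤-pred (Fin.toℕ<n a)))))
    a≡sink : a ≡ sink k₁
    a≡sink = Fin.toℕ-injective (trans a≡ (trans (cong (suc k₁ +_) b≡0)
               (trans (+-identityʳ (suc k₁)) (sym (toℕ-sink k₁)))))
    b≡zero : b ≡ zero
    b≡zero = Fin.toℕ-injective b≡0

  par₁-cases : ∀ a → (a ≡ sink k₁ × par₁ k₁ k₂ a ≡ sink (k₁ + k₂)) ⊎ (toℕ a ≤ k₁ × toℕ (par₁ k₁ k₂ a) ≡ toℕ a)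
  par₁-cases a with toℕ a ≟ suc k₁
  ... | yes a≡ = inj₁ (Fin.toℕ-injective (trans a≡ (sym (toℕ-sink k₁))) , refl)
  ... | no  a≢ = inj₂ (≤-pred (≤∧≢⇒< (≤-pred (Fin.toℕ<n a)) a≢) , Fin.toℕ-inject≤ a _)

  par₁-sink : par₁ k₁ k₂ (sink k₁) ≡ sink (k₁ + k₂)
  par₁-sink with par₁-cases (sink k₁)
  ... | inj₁ (_ , e)  = e
  ... | inj₂ (le , _) = ⊥-elim (1+n≰n (subst (_≤ k₁) (toℕ-sink k₁) le))

  toℕ-par₂ : ∀ j → toℕ (par₂ k₁ k₂ (suc j)) ≡ suc (k₁ + toℕ j)
  toℕ-par₂ j = trans (Fin.toℕ-cast (trans (+-suc k₁ (suc k₂)) (cong suc (+-suc k₁ k₂))) (k₁ Fin.↑ʳ suc j))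
                     (trans (Fin.toℕ-↑ʳ k₁ (suc j)) (+-suc k₁ (toℕ j)))

  par₂-sink : par₂ k₁ k₂ (sink k₂) ≡ sink (k₁ + k₂)
  par₂-sink = Fin.toℕ-injective (trans (toℕ-par₂ (fromℕ k₂))
                (trans (cong (λ x → suc (k₁ + x)) (Fin.toℕ-fromℕ k₂)) (sym (toℕ-sink (k₁ + k₂)))))

  sink≰k₁ : ¬ toℕ (sink (k₁ + k₂)) ≤ k₁
  sink≰k₁ le = 1+n≰n (≤-trans (s≤s (m≤m+n k₁ k₂)) (subst (_≤ k₁) (toℕ-sink (k₁ + k₂)) le))

  par₁-injective : Injective _≡_ _≡_ (par₁ k₁ k₂)
  par₁-injective {a} {a′} e with par₁-cases a | par₁-cases a′
  ... | inj₁ (a≡ , _) | inj₁ (a′≡ , _) = trans a≡ (sym a′≡)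
  ... | inj₂ (_ , ≡a) | inj₂ (_ , ≡a′) = Fin.toℕ-injective (trans (sym ≡a) (trans (cong toℕ e) ≡a′))
  ... | inj₁ (_ , ≡s) | inj₂ (le , ≡a′) =
    ⊥-elim (sink≰k₁ (subst (_≤ k₁) (trans (sym ≡a′) (cong toℕ (trans (sym e) ≡s))) le))
  ... | inj₂ (le , ≡a) | inj₁ (_ , ≡s) =
    ⊥-elim (sink≰k₁ (subst (_≤ k₁) (trans (sym ≡a) (cong toℕ (trans e ≡s))) le))

  toℕ-par₁-inner : ∀ {a} → toℕ a ≤ k₁ → toℕ (par₁ k₁ k₂ a) ≡ toℕ a
  toℕ-par₁-inner {a} le with par₁-cases a
  ... | inj₁ (refl , _) = ⊥-elim (1+n≰n (subst (_≤ k₁) (toℕ-sink k₁) le))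
  ... | inj₂ (_ , e)    = e

  par₂-injective : Injective _≡_ _≡_ (par₂ k₁ k₂)
  par₂-injective {zero}  {zero}   e = refl
  par₂-injective {zero}  {suc b′} e = ⊥-elim (0≢1+n (trans (cong toℕ e) (toℕ-par₂ b′)))
  par₂-injective {suc b} {zero}   e = ⊥-elim (0≢1+n (trans (cong toℕ (sym e)) (toℕ-par₂ b)))
  par₂-injective {suc b} {suc b′} e = cong suc (Fin.toℕ-injective (+-cancelˡ-≡ k₁ _ _
    (suc-injective (trans (sym (toℕ-par₂ b)) (trans (cong toℕ e) (toℕ-par₂ b′))))))

  par-cover : ∀ v → (∃ λ a → par₁ k₁ k₂ a ≡ v) ⊎ (∃ λ b → par₂ k₁ k₂ b ≡ v)
  par-cover v with toℕ v ≤? k₁ | toℕ v ≟ suc (k₁ + k₂)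
  ... | yes v≤k₁ | _ = inj₁ (a , Fin.toℕ-injective (trans (toℕ-par₁-inner a≤k₁) a≡v))
    where
    a : Fin (2 + k₁)
    a = fromℕ< (s≤s (m≤n⇒m≤1+n v≤k₁))
    a≡v : toℕ a ≡ toℕ v
    a≡v = Fin.toℕ-fromℕ< (s≤s (m≤n⇒m≤1+n v≤k₁))
    a≤k₁ : toℕ a ≤ k₁
    a≤k₁ = subst (_≤ k₁) (sym a≡v) v≤k₁
  ... | no  _    | yes v≡sink =
    inj₁ (sink k₁ , trans par₁-sink (Fin.toℕ-injective (trans (toℕ-sink (k₁ + k₂)) (sym v≡sink))))
  ... | no  v≰k₁ | no  v≢sink = inj₂ (suc b , Fin.toℕ-injective (begin
    toℕ (par₂ k₁ k₂ (suc b))     ≡⟨ toℕ-par₂ b ⟩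
    suc k₁ + toℕ b               ≡⟨ cong (suc k₁ +_) (Fin.toℕ-fromℕ< b<) ⟩
    suc k₁ + (toℕ v ∸ suc k₁)    ≡⟨ m+[n∸m]≡n (≰⇒> v≰k₁) ⟩
    toℕ v                        ∎))
    where
    open ≡-Reasoning
    b< : toℕ v ∸ suc k₁ < suc k₂
    b< = m<n⇒m<1+n (subst (toℕ v ∸ suc k₁ <_) (m+n∸m≡n (suc k₁) k₂)
           (∸-monoˡ-< (≤∧≢⇒< (≤-pred (Fin.toℕ<n v)) v≢sink) (≰⇒> v≰k₁)))
    b : Fin (suc k₂)
    b = fromℕ< b<

  par-overlap : ∀ {a b} → par₁ k₁ k₂ a ≡ par₂ k₁ k₂ b →
                (a ≡ zero × b ≡ zero) ⊎ (a ≡ sink k₁ × b ≡ sink k₂)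
  par-overlap {a} {zero}  e = inj₁ (par₁-injective e , refl)
  par-overlap {a} {suc j} e with par₁-cases a
  ... | inj₁ (a≡ , ≡sink) = inj₂ (a≡ , par₂-injective (trans (sym e) (trans ≡sink (sym par₂-sink))))
  ... | inj₂ (a≤k₁ , ≡a)  = ⊥-elim (1+n≰n (≤-trans (s≤s (m≤m+n k₁ (toℕ j)))
                              (subst (_≤ k₁) (trans (sym ≡a) (trans (cong toℕ e) (toℕ-par₂ j))) a≤k₁)))

module Composition {m₁ m₂ n : ℕ} (e₁ : Fin m₁ → Fin n) (e₂ : Fin m₂ → Fin n)
                   (A₁ : Arcs m₁) (A₂ : Arcs m₂) where

  composite : Arcs n
  composite = map (mapArc e₁) A₁ ++ map (mapArc e₂) A₂

  increasing-restrictˡ : ∀ {f} → Increasing f composite → Increasing (f ∘ e₁) A₁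
  increasing-restrictˡ f↑ uv∈A₁ = f↑ (∈-++⁺ˡ (∈-map⁺ (mapArc e₁) uv∈A₁))

  increasing-restrictʳ : ∀ {f} → Increasing f composite → Increasing (f ∘ e₂) A₂
  increasing-restrictʳ f↑ uv∈A₂ = f↑ (∈-++⁺ʳ (map (mapArc e₁) A₁) (∈-map⁺ (mapArc e₂) uv∈A₂))

  increasing-extend : ∀ {f f₁ f₂} → (∀ a → f (e₁ a) ≡ f₁ a) → (∀ b → f (e₂ b) ≡ f₂ b) →
                      Increasing f₁ A₁ → Increasing f₂ A₂ → Increasing f composite
  increasing-extend ≡f₁ ≡f₂ f₁↑ f₂↑ uv∈A with ∈-++⁻ (map (mapArc e₁) A₁) uv∈A
  ... | inj₁ ∈₁ with (a , a′) , aa′∈ , refl ← ∈-map⁻ (mapArc e₁) ∈₁ =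
    subst₂ _<_ (sym (≡f₁ a)) (sym (≡f₁ a′)) (f₁↑ aa′∈)
  ... | inj₂ ∈₂ with (b , b′) , bb′∈ , refl ← ∈-map⁻ (mapArc e₂) ∈₂ =
    subst₂ _<_ (sym (≡f₂ b)) (sym (≡f₂ b′)) (f₂↑ bb′∈)

  cut-split : ∀ f i → cut f composite i ≡ cut (f ∘ e₁) A₁ i + cut (f ∘ e₂) A₂ i
  cut-split f i = trans (cut-++ f (map (mapArc e₁) A₁) (map (mapArc e₂) A₂) i)
                        (cong₂ _+_ (cut-map f e₁ A₁ i) (cut-map f e₂ A₂ i))

module Glue {m₁ m₂ n : ℕ} {e₁ : Fin m₁ → Fin n} {e₂ : Fin m₂ → Fin n}
            (cover : ∀ v → (∃ λ a → e₁ a ≡ v) ⊎ (∃ λ b → e₂ b ≡ v))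
            (f₁ : Fin m₁ → ℕ) (f₂ : Fin m₂ → ℕ) where

  glue : Fin n → ℕ
  glue v = [ f₁ ∘ proj₁ , f₂ ∘ proj₁ ]′ (cover v)

  module _ (e₁-injective : Injective _≡_ _≡_ e₁) (e₂-injective : Injective _≡_ _≡_ e₂)
           (compatible : ∀ {a b} → e₁ a ≡ e₂ b → f₁ a ≡ f₂ b) where

    glue-e₁ : ∀ a → glue (e₁ a) ≡ f₁ a
    glue-e₁ a with cover (e₁ a)
    ... | inj₁ (a′ , e) = cong f₁ (e₁-injective e)
    ... | inj₂ (b , e)  = sym (compatible (sym e))

    glue-e₂ : ∀ b → glue (e₂ b) ≡ f₂ b
    glue-e₂ b with cover (e₂ b)
    ... | inj₁ (a , e)  = compatible e
    ... | inj₂ (b′ , e) = cong f₂ (e₂-injective e)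

  glue-< : ∀ {k} → (∀ a → f₁ a < k) → (∀ b → f₂ b < k) → ∀ v → glue v < k
  glue-< f₁<k f₂<k v with cover v
  ... | inj₁ (a , _) = f₁<k a
  ... | inj₂ (b , _) = f₂<k b

  glue-injective : Injective _≡_ _≡_ f₁ → Injective _≡_ _≡_ f₂ → (∀ {a b} → f₁ a ≡ f₂ b → e₁ a ≡ e₂ b) →
                   Injective _≡_ _≡_ glue
  glue-injective f₁-inj f₂-inj cross {u} {v} e with cover u | cover v
  ... | inj₁ (a , refl) | inj₁ (a′ , refl) = cong e₁ (f₁-inj e)
  ... | inj₂ (b , refl) | inj₂ (b′ , refl) = cong e₂ (f₂-inj e)
  ... | inj₁ (a , refl) | inj₂ (b , refl)  = cross e
  ... | inj₂ (b , refl) | inj₁ (a , refl)  = sym (cross (sym e))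

module Ser (g h : SPD) = Composition (ser₁ (size g) (size h)) (ser₂ (size g) (size h)) (arcs g) (arcs h)
module Par (g h : SPD) = Composition (par₁ (size g) (size h)) (par₂ (size g) (size h)) (arcs g) (arcs h)

Extremal : ∀ k → (Fin (2 + k) → ℕ) → Set
Extremal k f = ∀ v → f zero ≤ f v × f v ≤ f (sink k)

ser-extremal : ∀ {k₁ k₂} (f : Fin (2 + (k₁ + suc k₂)) → ℕ) →
  Extremal k₁ (f ∘ ser₁ k₁ k₂) → Extremal k₂ (f ∘ ser₂ k₁ k₂) → Extremal (k₁ + suc k₂) f
ser-extremal {k₁} {k₂} f ext₁ ext₂ v with ser-cover k₁ k₂ v
... | inj₁ (a , refl) = proj₁ (ext₁ a) , (begin
  f (ser₁ k₁ k₂ a)            ≤⟨ proj₂ (ext₁ a) ⟩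
  f (ser₁ k₁ k₂ (sink k₁))    ≡⟨ cong f (ser-junction k₁ k₂) ⟩
  f (ser₂ k₁ k₂ zero)         ≤⟨ proj₂ (ext₂ zero) ⟩
  f (ser₂ k₁ k₂ (sink k₂))    ≡⟨ cong f (ser₂-sink k₁ k₂) ⟩
  f (sink (k₁ + suc k₂))      ∎)
  where open ≤-Reasoning
... | inj₂ (b , refl) = (begin
  f zero                      ≤⟨ proj₁ (ext₁ (sink k₁)) ⟩
  f (ser₁ k₁ k₂ (sink k₁))    ≡⟨ cong f (ser-junction k₁ k₂) ⟩
  f (ser₂ k₁ k₂ zero)         ≤⟨ proj₁ (ext₂ b) ⟩
  f (ser₂ k₁ k₂ b)            ∎) , subst (f (ser₂ k₁ k₂ b) ≤_) (cong f (ser₂-sink k₁ k₂)) (proj₂ (ext₂ b))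
  where open ≤-Reasoning

par-extremal : ∀ {k₁ k₂} (f : Fin (2 + (k₁ + k₂)) → ℕ) →
  Extremal k₁ (f ∘ par₁ k₁ k₂) → Extremal k₂ (f ∘ par₂ k₁ k₂) → Extremal (k₁ + k₂) f
par-extremal {k₁} {k₂} f ext₁ ext₂ v with par-cover k₁ k₂ v
... | inj₁ (a , refl) = proj₁ (ext₁ a) , subst (f (par₁ k₁ k₂ a) ≤_) (cong f (par₁-sink k₁ k₂)) (proj₂ (ext₁ a))
... | inj₂ (b , refl) = proj₁ (ext₂ b) , subst (f (par₂ k₁ k₂ b) ≤_) (cong f (par₂-sink k₁ k₂)) (proj₂ (ext₂ b))

spd-extremal : ∀ g (f : Fin (2 + size g) → ℕ) → Increasing f (arcs g) → Extremal (size g) f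
spd-extremal arc f f↑ zero       = ≤-refl , <⇒≤ (f↑ (here refl))
spd-extremal arc f f↑ (suc zero) = <⇒≤ (f↑ (here refl)) , ≤-refl
spd-extremal (g ∘ₛ h) f f↑ = ser-extremal f
  (spd-extremal g _ (Ser.increasing-restrictˡ g h f↑)) (spd-extremal h _ (Ser.increasing-restrictʳ g h f↑))
spd-extremal (g ∥ h) f f↑ = par-extremal f
  (spd-extremal g _ (Par.increasing-restrictˡ g h f↑)) (spd-extremal h _ (Par.increasing-restrictʳ g h f↑))

module _ (g : SPD) (N : TopNumbering (2 + size g) (arcs g)) where

  num-source : num N zero ≡ 0
  num-source with num-onto N 0 (s≤s z≤n)
  ... | v , v≡0 = n≤0⇒n≡0 (subst (num N zero ≤_) v≡0 (proj₁ (spd-extremal g (num N) (increasing N) v)))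

  num-sink : num N (sink (size g)) ≡ suc (size g)
  num-sink with num-onto N (suc (size g)) ≤-refl
  ... | v , v≡ = ≤-antisym (≤-pred (num<n N _))
                   (subst (_≤ num N (sink (size g))) v≡ (proj₂ (spd-extremal g (num N) (increasing N) v)))

-- Series composition

module Series (g h : SPD) where

  private
    k₁ k₂ : ℕ
    k₁ = size g
    k₂ = size h

  open Ser g h

  cutSeq-series : (f : Fin (2 + (k₁ + suc k₂)) → ℕ) (f₁ : Fin (2 + k₁) → ℕ) (f₂ : Fin (2 + k₂) → ℕ) →
    (∀ a → f (ser₁ k₁ k₂ a) ≡ f₁ a) → (∀ b → f (ser₂ k₁ k₂ b) ≡ suc k₁ + f₂ b) → (∀ a → f₁ a ≤ suc k₁) →
    cutSeq f (arcs (g ∘ₛ h)) (suc (k₁ + suc k₂)) ≡ cutSeq f₁ (arcs g) (suc k₁) ++ cutSeq f₂ (arcs h) (suc k₂)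
  cutSeq-series f f₁ f₂ ≡f₁ ≡f₂ f₁≤ =
    trans (applyUpTo-+ (λ i → cut f (arcs (g ∘ₛ h)) (suc i)) (suc k₁) (suc k₂))
          (cong₂ _++_ (applyUpTo-cong _ _ (suc k₁) first) (applyUpTo-cong _ _ (suc k₂) second))
    where
    open ≡-Reasoning
    first : ∀ i → i < suc k₁ → cut f (arcs (g ∘ₛ h)) (suc i) ≡ cut f₁ (arcs g) (suc i)
    first i i<1+k₁ = begin
      cut f (arcs (g ∘ₛ h)) (suc i)                                          ≡⟨ cut-split f (suc i) ⟩
      cut (f ∘ ser₁ k₁ k₂) (arcs g) (suc i) + cut (f ∘ ser₂ k₁ k₂) (arcs h) (suc i)
        ≡⟨ cong₂ _+_ (cut-cong _ f₁ (arcs g) (λ a < → subst (_< suc i) (≡f₁ a) <)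
                                             (λ a < → subst (_< suc i) (sym (≡f₁ a)) <))
                     (cut-≤all _ (arcs h) (suc i) λ b → subst (suc i ≤_) (sym (≡f₂ b))
                                                        (≤-trans i<1+k₁ (m≤m+n (suc k₁) (f₂ b)))) ⟩
      cut f₁ (arcs g) (suc i) + 0                                            ≡⟨ +-identityʳ _ ⟩
      cut f₁ (arcs g) (suc i)                                                ∎
    second : ∀ j → j < suc k₂ → cut f (arcs (g ∘ₛ h)) (suc (suc k₁ + j)) ≡ cut f₂ (arcs h) (suc j)
    second j _ = begin
      cut f (arcs (g ∘ₛ h)) (suc (suc k₁ + j))                                ≡⟨ cut-split f _ ⟩
      cut (f ∘ ser₁ k₁ k₂) (arcs g) _ + cut (f ∘ ser₂ k₁ k₂) (arcs h) _
        ≡⟨ cong₂ _+_ (cut-all< _ (arcs g) _ λ a → subst (_< suc (suc k₁ + j)) (sym (≡f₁ a))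
                                                   (s≤s (≤-trans (f₁≤ a) (m≤m+n (suc k₁) j))))
                     (cut-cong _ f₂ (arcs h)
                       (λ b < → +-cancelˡ-< (suc k₁) _ _ (subst₂ _<_ (≡f₂ b) (sym (+-suc (suc k₁) j)) <))
                       (λ b < → subst₂ _<_ (sym (≡f₂ b)) (+-suc (suc k₁) j) (+-monoʳ-< (suc k₁) <))) ⟩
      0 + cut f₂ (arcs h) (suc j)                                            ≡⟨⟩
      cut f₂ (arcs h) (suc j)                                                ∎

  module Split (N : TopNumbering (2 + (k₁ + suc k₂)) (arcs (g ∘ₛ h))) where

    junction : ℕ
    junction = num N (ser₂ k₁ k₂ zero)

    ≤junction : ∀ a → num N (ser₁ k₁ k₂ a) ≤ junction
    ≤junction a = subst (num N (ser₁ k₁ k₂ a) ≤_) (cong (num N) (ser-junction k₁ k₂))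
                        (proj₂ (spd-extremal g _ (increasing-restrictˡ (increasing N)) a))

    junction≤ : ∀ b → junction ≤ num N (ser₂ k₁ k₂ b)
    junction≤ b = proj₁ (spd-extremal h _ (increasing-restrictʳ (increasing N)) b)

    vertices≡ : 2 + (k₁ + suc k₂) ≡ (2 + k₂) + suc k₁
    vertices≡ = cong (2 +_) (trans (+-comm k₁ (suc k₂)) (sym (+-suc k₂ k₁)))

    -- Pigeonhole: the 2 + k₁ vertices of g are numbered ≤ junction, the 2 + k₂ vertices of h ≥ junction.
    junction≡ : junction ≡ suc k₁
    junction≡ = ≤-antisym junction≤1+k₁ 1+k₁≤junction
      where
      1+k₁≤junction : suc k₁ ≤ junction
      1+k₁≤junction =
        ≤-pred (injective⇒≤ (num N ∘ ser₁ k₁ k₂) (ser₁-injective k₁ k₂ ∘ injective N) (s≤s ∘ ≤junction))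
      above : Fin (2 + k₂) → ℕ
      above b = num N (ser₂ k₁ k₂ b) ∸ junction
      above-injective : Injective _≡_ _≡_ above
      above-injective e = ser₂-injective k₁ k₂ (injective N (∸-cancelʳ-≡ (junction≤ _) (junction≤ _) e))
      junction≤1+k₁ : junction ≤ suc k₁
      junction≤1+k₁ = +-cancelˡ-≤ (2 + k₂) _ _ (subst (2 + k₂ + junction ≤_) vertices≡
        (m≤o∸n⇒m+n≤o (2 + k₂) (<⇒≤ (num<n N _))
          (injective⇒≤ above above-injective λ b → ∸-monoˡ-< (num<n N _) (junction≤ b))))

    1+k₁≤ : ∀ b → suc k₁ ≤ num N (ser₂ k₁ k₂ b)
    1+k₁≤ b = subst (_≤ num N (ser₂ k₁ k₂ b)) junction≡ (junction≤ b)

    N₁ : TopNumbering (2 + k₁) (arcs g)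
    N₁ = record
      { num        = num N ∘ ser₁ k₁ k₂
      ; num<n      = λ a → s≤s (subst (num N (ser₁ k₁ k₂ a) ≤_) junction≡ (≤junction a))
      ; injective  = ser₁-injective k₁ k₂ ∘ injective N
      ; increasing = increasing-restrictˡ (increasing N)
      }

    N₂ : TopNumbering (2 + k₂) (arcs h)
    N₂ = record
      { num        = λ b → num N (ser₂ k₁ k₂ b) ∸ suc k₁
      ; num<n      = λ b → subst (num N (ser₂ k₁ k₂ b) ∸ suc k₁ <_)
                             (trans (cong (_∸ suc k₁) (trans vertices≡ (+-comm (2 + k₂) (suc k₁))))
                                    (m+n∸m≡n (suc k₁) (2 + k₂)))
                             (∸-monoˡ-< (num<n N _) (1+k₁≤ b))
      ; injective  = λ e → ser₂-injective k₁ k₂ (injective N (∸-cancelʳ-≡ (1+k₁≤ _) (1+k₁≤ _) e))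
      ; increasing = λ {u} uv∈ → ∸-monoˡ-< (increasing-restrictʳ (increasing N) uv∈) (1+k₁≤ u)
      }

    cutSeq-split : cutSeq (num N) (arcs (g ∘ₛ h)) (suc (k₁ + suc k₂))
                 ≡ cutSeq (num N₁) (arcs g) (suc k₁) ++ cutSeq (num N₂) (arcs h) (suc k₂)
    cutSeq-split = cutSeq-series (num N) (num N₁) (num N₂) (λ _ → refl)
                     (λ b → sym (m+[n∸m]≡n (1+k₁≤ b))) (λ a → ≤-pred (num<n N₁ a))

  module Join (N₁ : TopNumbering (2 + k₁) (arcs g)) (N₂ : TopNumbering (2 + k₂) (arcs h)) where

    shifted : Fin (2 + k₂) → ℕ
    shifted b = suc k₁ + num N₂ b

    open Glue (ser-cover k₁ k₂) (num N₁) shifted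

    compatible : ∀ {a b} → ser₁ k₁ k₂ a ≡ ser₂ k₁ k₂ b → num N₁ a ≡ shifted b
    compatible e with ser-overlap k₁ k₂ e
    ... | refl , refl = trans (num-sink g N₁)
                         (sym (trans (cong (suc k₁ +_) (num-source h N₂)) (+-identityʳ (suc k₁))))

    meet-at-junction : ∀ {a b} → num N₁ a ≡ shifted b → ser₁ k₁ k₂ a ≡ ser₂ k₁ k₂ b
    meet-at-junction {a} {b} e = subst₂ (λ a b → ser₁ k₁ k₂ a ≡ ser₂ k₁ k₂ b) (sym a≡sink) (sym b≡zero)
                                   (ser-junction k₁ k₂)
      where
      b≡0 : num N₂ b ≡ 0
      b≡0 = n≤0⇒n≡0 (+-cancelˡ-≤ (suc k₁) _ _
              (subst (_≤ suc k₁ + 0) e (subst (num N₁ a ≤_) (sym (+-identityʳ _)) (≤-pred (num<n N₁ a)))))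
      b≡zero : b ≡ zero
      b≡zero = injective N₂ (trans b≡0 (sym (num-source h N₂)))
      a≡sink : a ≡ sink k₁
      a≡sink = injective N₁ (trans e (trans (cong (suc k₁ +_) b≡0)
                 (trans (+-identityʳ (suc k₁)) (sym (num-sink g N₁)))))

    N : TopNumbering (2 + (k₁ + suc k₂)) (arcs (g ∘ₛ h))
    N = record
      { num        = glue
      ; num<n      = glue-< (λ a → ≤-trans (num<n N₁ a) (s≤s (s≤s (m≤m+n k₁ (suc k₂)))))
                            (λ b → subst (shifted b <_) (cong suc (+-suc k₁ (suc k₂)))
                                         (+-monoʳ-< (suc k₁) (num<n N₂ b)))
      ; injective  = glue-injective (injective N₁) (injective N₂ ∘ +-cancelˡ-≡ (suc k₁) _ _) meet-at-junction
      ; increasing = increasing-extend (glue-e₁ (ser₁-injective k₁ k₂) (ser₂-injective k₁ k₂) compatible)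
                                       (glue-e₂ (ser₁-injective k₁ k₂) (ser₂-injective k₁ k₂) compatible)
                                       (increasing N₁) (+-monoʳ-< (suc k₁) ∘ increasing N₂)
      }

    cutSeq-join : cutSeq (num N) (arcs (g ∘ₛ h)) (suc (k₁ + suc k₂))
                ≡ cutSeq (num N₁) (arcs g) (suc k₁) ++ cutSeq (num N₂) (arcs h) (suc k₂)
    cutSeq-join = cutSeq-series glue (num N₁) (num N₂)
                    (glue-e₁ (ser₁-injective k₁ k₂) (ser₂-injective k₁ k₂) compatible)
                    (glue-e₂ (ser₁-injective k₁ k₂) (ser₂-injective k₁ k₂) compatible)
                    (λ a → ≤-pred (num<n N₁ a))

  series : Css (g ∘ₛ h) ≐ (Css g ⊙ Css h)
  series s = mk⇔
    (λ (N , ≡s) → let open Split N in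
       _ , _ , (N₁ , refl) , (N₂ , refl) , trans (sym ≡s) cutSeq-split)
    (λ (a , b , (N₁ , ≡a) , (N₂ , ≡b) , s≡) → let open Join N₁ N₂ in
       N , trans cutSeq-join (trans (cong₂ _++_ ≡a ≡b) (sym s≡)))

-- Parallel composition

rankNumbering : ∀ {m} {A : Arcs m} (φ : Fin m → ℕ) → Injective _≡_ _≡_ φ → Increasing φ A → TopNumbering m A
rankNumbering φ φ-inj φ↑ = record
  { num = rank φ ; num<n = rank<m φ ; injective = rank-injective φ φ-inj ; increasing = rank-strict φ ∘ φ↑ }

cut-rank : ∀ {m} (φ : Fin m → ℕ) A i → cut φ A i ≡ cut (rank φ) A (countBelow φ i)
cut-rank φ A i = cut-cong φ (rank φ) A (λ x → rank<⇐ φ x i) (λ x → rank<⇒ φ x i)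

countBelow-step : ∀ {m} (φ : Fin m → ℕ) c w k →
  countBelow φ (suc k) ≡ suc (count c w k) → countAt φ (suc k) ≡ hit c (w k) →
  countBelow φ (suc (suc k)) ≡ suc (count c w (suc k))
countBelow-step φ c w k below≡ at≡ = begin
  countBelow φ (suc (suc k))                ≡⟨ countBelow-suc φ (suc k) ⟩
  countBelow φ (suc k) + countAt φ (suc k)  ≡⟨ cong₂ _+_ below≡ at≡ ⟩
  suc (count c w k + hit c (w k))           ≡⟨ cong suc (sym (count-suc c w k)) ⟩
  suc (count c w (suc k))                   ∎
  where open ≡-Reasoning

countBelow-one : ∀ {m} (φ : Fin m → ℕ) → Injective _≡_ _≡_ φ → ∀ {x} → φ x ≡ 0 → countBelow φ 1 ≡ 1
countBelow-one φ φ-inj φx≡0 =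
  trans (countBelow-suc φ 0) (cong₂ _+_ (countBelow-zero φ) (countAt-unique φ φ-inj φx≡0))

countBelow-last : ∀ {m} (φ : Fin m → ℕ) → Injective _≡_ _≡_ φ → ∀ {x l} → φ x ≡ l → (∀ y → φ y ≤ l) →
                  countBelow φ l + 1 ≡ m
countBelow-last φ φ-inj {x} {l} φx≡l φ≤l = begin
  countBelow φ l + 1           ≡⟨ cong (countBelow φ l +_) (sym (countAt-unique φ φ-inj φx≡l)) ⟩
  countBelow φ l + countAt φ l ≡⟨ sym (countBelow-suc φ l) ⟩
  countBelow φ (suc l)         ≡⟨ countBelow-all φ (suc l) (s≤s ∘ φ≤l) ⟩
  _                            ∎
  where open ≡-Reasoning

module Parallel (g h : SPD) where

  private
    k₁ k₂ L : ℕ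
    k₁ = size g
    k₂ = size h
    L  = k₁ + k₂

  open Par g h

  module Split (N : TopNumbering (2 + L) (arcs (g ∥ h))) where

    φ₁ : Fin (2 + k₁) → ℕ
    φ₁ = num N ∘ par₁ k₁ k₂

    φ₂ : Fin (2 + k₂) → ℕ
    φ₂ = num N ∘ par₂ k₁ k₂

    φ₁-injective : Injective _≡_ _≡_ φ₁
    φ₁-injective = par₁-injective k₁ k₂ ∘ injective N

    φ₂-injective : Injective _≡_ _≡_ φ₂
    φ₂-injective = par₂-injective k₁ k₂ ∘ injective N

    N₁ : TopNumbering (2 + k₁) (arcs g)
    N₁ = rankNumbering φ₁ φ₁-injective (increasing-restrictˡ (increasing N))

    N₂ : TopNumbering (2 + k₂) (arcs h)
    N₂ = rankNumbering φ₂ φ₂-injective (increasing-restrictʳ (increasing N))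

    not-shared : ∀ {a b p} → φ₁ a ≡ p → φ₂ b ≡ p → 0 < p → p ≤ L → ⊥
    not-shared {a} {b} a≡p b≡p 0<p p≤L with par-overlap k₁ k₂ {a} {b} (injective N (trans a≡p (sym b≡p)))
    ... | inj₁ (refl , _) = <⇒≢ 0<p (trans (sym (num-source (g ∥ h) N)) a≡p)
    ... | inj₂ (refl , _) = 1+n≰n (subst (_≤ L) (trans (sym a≡p) (trans (cong (num N) (par₁-sink k₁ k₂))
                                                   (num-sink (g ∥ h) N))) p≤L)

    inner-side : ∀ p → 0 < p → p ≤ L →
                 (countAt φ₁ p ≡ 1 × countAt φ₂ p ≡ 0) ⊎ (countAt φ₁ p ≡ 0 × countAt φ₂ p ≡ 1)
    inner-side p 0<p p≤L with num-onto N p (m≤n⇒m≤1+n (s≤s p≤L))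
    ... | v , v≡p with par-cover k₁ k₂ v
    ...   | inj₁ (a , refl) = inj₁ (countAt-unique φ₁ φ₁-injective {a} v≡p ,
                                   countAt-none φ₂ p λ b b≡p → not-shared {a} {b} v≡p b≡p 0<p p≤L)
    ...   | inj₂ (b , refl) = inj₂ (countAt-none φ₁ p (λ a a≡p → not-shared {a} {b} a≡p v≡p 0<p p≤L) ,
                                   countAt-unique φ₂ φ₂-injective {b} v≡p)

    -- Step k + 1 of the path moves on the side of the vertex at position k + 1.
    steps : ℕ → Bool
    steps k = does (countAt φ₂ (suc k) ≟ 1)

    countAt-steps : ∀ k → suc k ≤ L →
                    countAt φ₁ (suc k) ≡ hit false (steps k) × countAt φ₂ (suc k) ≡ hit true (steps k)
    countAt-steps k k<L with inner-side (suc k) (s≤s z≤n) k<L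
    ... | inj₁ (at₁≡ , at₂≡) rewrite at₁≡ | at₂≡ = refl , refl
    ... | inj₂ (at₁≡ , at₂≡) rewrite at₁≡ | at₂≡ = refl , refl

    countBelow-steps : ∀ k → k ≤ L →
      countBelow φ₁ (suc k) ≡ suc (count false steps k) × countBelow φ₂ (suc k) ≡ suc (count true steps k)
    countBelow-steps zero _ = countBelow-one φ₁ φ₁-injective {zero} (num-source (g ∥ h) N) ,
                              countBelow-one φ₂ φ₂-injective {zero} (num-source (g ∥ h) N)
    countBelow-steps (suc k) k<L =
      let (below₁ , below₂) = countBelow-steps k (<⇒≤ k<L)
          (at₁ , at₂) = countAt-steps k k<L
      in countBelow-step φ₁ false steps k below₁ at₁ , countBelow-step φ₂ true steps k below₂ at₂

    count-steps : count false steps L ≡ k₁ × count true steps L ≡ k₂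
    count-steps =
      from-total φ₁ φ₁-injective (λ _ → ≤-pred (num<n N _))
        (trans (cong (num N) (par₁-sink k₁ k₂)) (num-sink (g ∥ h) N)) (proj₁ (countBelow-steps L ≤-refl)) ,
      from-total φ₂ φ₂-injective (λ _ → ≤-pred (num<n N _))
        (trans (cong (num N) (par₂-sink k₁ k₂)) (num-sink (g ∥ h) N)) (proj₂ (countBelow-steps L ≤-refl))
      where
      from-total : ∀ {m c} (φ : Fin (2 + m) → ℕ) → Injective _≡_ _≡_ φ → (∀ y → φ y ≤ suc L) →
                   φ (sink m) ≡ suc L → countBelow φ (suc L) ≡ suc c → c ≡ m
      from-total {m} {c} φ φ-inj φ≤ φsink≡ below≡ = suc-injective (suc-injective (begin
        suc (suc c)                ≡⟨ +-comm 1 (suc c) ⟩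
        suc c + 1                  ≡⟨ cong (_+ 1) (sym below≡) ⟩
        countBelow φ (suc L) + 1   ≡⟨ countBelow-last φ φ-inj φsink≡ φ≤ ⟩
        2 + m                      ∎))
        where open ≡-Reasoning

    cut-steps : ∀ k → k ≤ L →
      cut (num N) (arcs (g ∥ h)) (suc k)
        ≡ cut (num N₁) (arcs g) (suc (count false steps k)) + cut (num N₂) (arcs h) (suc (count true steps k))
    cut-steps k k≤L = begin
      cut (num N) (arcs (g ∥ h)) (suc k)                        ≡⟨ cut-split (num N) (suc k) ⟩
      cut φ₁ (arcs g) (suc k) + cut φ₂ (arcs h) (suc k)
        ≡⟨ cong₂ _+_ (cut-rank φ₁ (arcs g) (suc k)) (cut-rank φ₂ (arcs h) (suc k)) ⟩
      cut (rank φ₁) (arcs g) (countBelow φ₁ (suc k)) + cut (rank φ₂) (arcs h) (countBelow φ₂ (suc k))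
        ≡⟨ cong₂ (λ i j → cut (rank φ₁) (arcs g) i + cut (rank φ₂) (arcs h) j)
                 (proj₁ (countBelow-steps k k≤L)) (proj₂ (countBelow-steps k k≤L)) ⟩
      cut (num N₁) (arcs g) (suc (count false steps k)) + cut (num N₂) (arcs h) (suc (count true steps k)) ∎
      where open ≡-Reasoning

    split-NDSum : NDSum (cutSeq (num N₁) (arcs g) (suc k₁)) (cutSeq (num N₂) (arcs h) (suc k₂))
                        (cutSeq (num N) (arcs (g ∥ h)) (suc L))
    split-NDSum = subst₂ (λ p q → NDSum (applyUpTo x (suc p)) (applyUpTo y (suc q))
                                         (cutSeq (num N) (arcs (g ∥ h)) (suc L)))
                    (proj₁ count-steps) (proj₂ count-steps)
                    (subst (NDSum _ _) (sym cutSeq≡pathSum) (pathSum-NDSum x y steps L))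
      where
      x y : ℕ → ℕ
      x = cut (num N₁) (arcs g) ∘ suc
      y = cut (num N₂) (arcs h) ∘ suc
      cutSeq≡pathSum : cutSeq (num N) (arcs (g ∥ h)) (suc L) ≡ pathSum x y steps L
      cutSeq≡pathSum = applyUpTo-cong _ _ (suc L) λ k k<1+L → cut-steps k (≤-pred k<1+L)

  module Join (N₁ : TopNumbering (2 + k₁) (arcs g)) (N₂ : TopNumbering (2 + k₂) (arcs h))
              (w : ℕ → Bool) (count₁ : count false w L ≡ k₁) (count₂ : count true w L ≡ k₂) where

    place₁ : Fin (2 + k₁) → ℕ
    place₁ a = slot false w L (num N₁ a)

    place₂ : Fin (2 + k₂) → ℕ
    place₂ b = slot true w L (num N₂ b)

    open Glue (par-cover k₁ k₂) place₁ place₂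

    num₁≤ : ∀ a → num N₁ a ≤ suc (count false w L)
    num₁≤ a = subst (λ K → num N₁ a ≤ suc K) (sym count₁) (≤-pred (num<n N₁ a))

    num₂≤ : ∀ b → num N₂ b ≤ suc (count true w L)
    num₂≤ b = subst (λ K → num N₂ b ≤ suc K) (sym count₂) (≤-pred (num<n N₂ b))

    place₁-sink : place₁ (sink k₁) ≡ suc L
    place₁-sink = trans (cong (slot false w L) (trans (num-sink g N₁) (cong suc (sym count₁))))
                        (slot-top false w L)

    place₂-sink : place₂ (sink k₂) ≡ suc L
    place₂-sink = trans (cong (slot true w L) (trans (num-sink h N₂) (cong suc (sym count₂))))
                        (slot-top true w L)

    compatible : ∀ {a b} → par₁ k₁ k₂ a ≡ par₂ k₁ k₂ b → place₁ a ≡ place₂ b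
    compatible {a} {b} e with par-overlap k₁ k₂ {a} {b} e
    ... | inj₁ (refl , refl) = trans (cong (slot false w L) (num-source g N₁))
                                     (sym (cong (slot true w L) (num-source h N₂)))
    ... | inj₂ (refl , refl) = trans place₁-sink (sym place₂-sink)

    meet-at-ends : ∀ {a b} → place₁ a ≡ place₂ b → par₁ k₁ k₂ a ≡ par₂ k₁ k₂ b
    meet-at-ends {a} {b} e with slot-coincide w L (num₁≤ a) (num₂≤ b) e
    ... | inj₁ (a≡0 , b≡0) = subst₂ (λ a b → par₁ k₁ k₂ a ≡ par₂ k₁ k₂ b)
                               (injective N₁ (trans (num-source g N₁) (sym a≡0)))
                               (injective N₂ (trans (num-source h N₂) (sym b≡0))) refl
    ... | inj₂ (a≡ , b≡)   = subst₂ (λ a b → par₁ k₁ k₂ a ≡ par₂ k₁ k₂ b)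
                               (injective N₁ (trans (num-sink g N₁) (trans (cong suc (sym count₁)) (sym a≡))))
                               (injective N₂ (trans (num-sink h N₂) (trans (cong suc (sym count₂)) (sym b≡))))
                               (trans (par₁-sink k₁ k₂) (sym (par₂-sink k₁ k₂)))

    glue-par₁ : ∀ a → glue (par₁ k₁ k₂ a) ≡ place₁ a
    glue-par₁ = glue-e₁ (par₁-injective k₁ k₂) (par₂-injective k₁ k₂) compatible

    glue-par₂ : ∀ b → glue (par₂ k₁ k₂ b) ≡ place₂ b
    glue-par₂ = glue-e₂ (par₁-injective k₁ k₂) (par₂-injective k₁ k₂) compatible

    N : TopNumbering (2 + L) (arcs (g ∥ h))
    N = record
      { num        = glue
      ; num<n      = glue-< (λ a → s≤s (slot-≤ false w L (num N₁ a))) (λ b → s≤s (slot-≤ true w L (num N₂ b)))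
      ; injective  = glue-injective (injective N₁ ∘ slot-injective false w L (num₁≤ _) (num₁≤ _))
                                    (injective N₂ ∘ slot-injective true w L (num₂≤ _) (num₂≤ _)) meet-at-ends
      ; increasing = increasing-extend glue-par₁ glue-par₂
                       (λ {_} {v} uv∈ → slot-strict false w L (increasing N₁ uv∈) (num₁≤ v))
                       (λ {_} {v} uv∈ → slot-strict true w L (increasing N₂ uv∈) (num₂≤ v))
      }

    cut-side : ∀ c {m} (f : Fin m → ℕ) (A : Arcs m) (e : Fin m → Fin (2 + L)) →
               (∀ x → glue (e x) ≡ slot c w L (f x)) →
               ∀ k → k ≤ L → cut (glue ∘ e) A (suc k) ≡ cut f A (suc (count c w k))
    cut-side c f A e ≡slot k k≤L = cut-cong _ f A
      (λ x < → slot<⇒ c w L (f x) k k≤L (subst (_< suc k) (≡slot x) <))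
      (λ x < → subst (_< suc k) (sym (≡slot x)) (slot<⇐ c w L (f x) k k≤L <))

    cutSeq-merge : cutSeq glue (arcs (g ∥ h)) (suc L)
                 ≡ pathSum (cut (num N₁) (arcs g) ∘ suc) (cut (num N₂) (arcs h) ∘ suc) w L
    cutSeq-merge = applyUpTo-cong _ _ (suc L) λ k k<1+L →
      trans (cut-split glue (suc k))
            (cong₂ _+_ (cut-side false (num N₁) (arcs g) (par₁ k₁ k₂) glue-par₁ k (≤-pred k<1+L))
                       (cut-side true (num N₂) (arcs h) (par₂ k₁ k₂) glue-par₂ k (≤-pred k<1+L)))

  parallel : Css (g ∥ h) ≐ (Css g ⊕nd Css h)
  parallel s = mk⇔
    (λ (N , ≡s) → let open Split N in
       _ , _ , (N₁ , refl) , (N₂ , refl) , subst (NDSum _ _) ≡s split-NDSum)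
    (λ (a , b , (N₁ , ≡a) , (N₂ , ≡b) , nd) →
       merge N₁ N₂ (NDSum-pathSum nd (cut (num N₁) (arcs g) ∘ suc) k₁
                                      (cut (num N₂) (arcs h) ∘ suc) k₂ (sym ≡a) (sym ≡b)))
    where
    merge : ∀ N₁ N₂ → (∃₂ λ w L′ → count false w L′ ≡ k₁ × count true w L′ ≡ k₂ ×
                         s ≡ pathSum (cut (num N₁) (arcs g) ∘ suc) (cut (num N₂) (arcs h) ∘ suc) w L′) →
            Css (g ∥ h) s
    merge N₁ N₂ (w , L′ , count₁ , count₂ , s≡)
      with refl ← trans (sym (count-false+true w L′)) (cong₂ _+_ count₁ count₂) =
      let open Join N₁ N₂ w count₁ count₂ in N , trans cutSeq-merge (sym s≡)

lemma4p4 : (G₁ G₂ : SPD)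
    → (cssT (G₁ ∘ₛ G₂) ≐ (cssT G₁ ⊙ cssT G₂)) × (cssT (G₁ ∥ G₂) ≐ (cssT G₁ ⊕nd cssT G₂))
lemma4p4 G₁ G₂ =
  ≐-trans (cssT≐Css (G₁ ∘ₛ G₂)) (≐-trans (Series.series G₁ G₂) (⊙-cong Css≐₁ Css≐₂)) ,
  ≐-trans (cssT≐Css (G₁ ∥ G₂)) (≐-trans (Parallel.parallel G₁ G₂) (⊕nd-cong Css≐₁ Css≐₂))
  where
  Css≐₁ : Css G₁ ≐ cssT G₁
  Css≐₁ = ≐-sym (cssT≐Css G₁)
  Css≐₂ : Css G₂ ≐ cssT G₂
  Css≐₂ = ≐-sym (cssT≐Css G₂)
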